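{- Let $p\ge 1$ and $q\ge 0$ be integers, and let $u$ be the unique element of the interval $[p,p+q]\cap\mathbb{Z}$ that maximizes $v_2(u)$. Then \[v_2\Big(\sum_{i=0}^{q}\frac{\binom{q}{i}}{p+i}\Big)=v_2\Big(\frac{\binom{q}{u-p}}{u}\Big).\]
   Context: $v_2$ denotes the $2$-adic valuation on nonzero rationals: $v_2(2^k a/b)=k$ for odd integers $a,b$. -}

module Defs where

open import Data.Nat using (ℕ; zero; suc; _+_; _%_; _/_)
open import Data.Nat.Combinatorics using (_C_)
open import Data.Integer using (ℤ; +_; _-_; ∣_∣)
open import Data.Rational using (ℚ; 0ℚ)
import Data.Rational as ℚ
open import Data.List using (List; map; foldr; upTo)

-- 2-adic valuation of a natural number (convention: v₂ℕ 0 = 0, only ever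
-- applied to nonzero numbers).  Fuel n suffices since n / 2 < n for n > 0.
v₂ℕ-aux : ℕ → ℕ → ℕ
v₂ℕ-aux zero n = 0
v₂ℕ-aux (suc f) zero = 0
v₂ℕ-aux (suc f) (suc m) with (suc m) % 2
... | zero = suc (v₂ℕ-aux f (suc m / 2))
... | suc _ = 0

v₂ℕ : ℕ → ℕ
v₂ℕ n = v₂ℕ-aux n n

-- 2-adic valuation of a rational a/b (in lowest terms): v₂(a) - v₂(b).
-- Meaningful for nonzero rationals (v₂ 0 = 0 by convention).
v₂ : ℚ → ℤ
v₂ r = + v₂ℕ ∣ ℚ.ℚ.numerator r ∣ - + v₂ℕ (ℚ.ℚ.denominatorℕ r)

-- the rational n / d for d ≥ 1 (junk value 0 when d = 0)
frac : ℕ → ℕ → ℚ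
frac n zero = 0ℚ
frac n (suc d) = (+ n) ℚ./ suc d

sumℚ : List ℚ → ℚ
sumℚ = foldr ℚ._+_ 0ℚ

S : ℕ → ℕ → ℚ
S p q = sumℚ (map (λ i → frac (q C i) (p + i)) (upTo (suc q)))

-- Comparing S(p, q + 1) term by
-- term with S(p, q) and S(p + 1, q), using Pascal's rule, the absorption identity
-- (k + 1) C(q + 1, k + 1) = (q + 1) C(q, k) and Σ_i C(q + 1, i) = 2^(q+1), gives
--   (p + q + 1) S(p, q + 1) = 2^(q+1) + (q + 1) S(p, q),
--   p S(p, q + 1) + (q + 1) S(p + 1, q) = 2^(q+1). By the induction hypothesis the term (q + 1) S(·, q) has valuation
-- v₂((q + 1) C(q, k) / u) ≤ v₂((q + 1)!) < q + 1 = v₂(2^(q+1)), so in each identity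
-- it determines the valuation of the term containing S(p, q + 1). If u = p, use the
-- first identity: v₂(p + q + 1) < v₂(p) forces v₂(p + q + 1) = v₂(q + 1). If u > p,
-- then u is also the maximiser on [p + 1, p + q + 1]; use the second identity:
-- writing u = p + m + 1, v₂(p) < v₂(u) forces v₂(m + 1) = v₂(p), and absorption
-- turns (q + 1) C(q, m) into (m + 1) C(q + 1, m + 1).

module Submission where

open import Defs
open import Data.Nat using (ℕ; _+_; _∸_; _≤_)
open import Data.Nat.Combinatorics using (_C_)
open import Data.Integer using (ℤ; +_)
import Data.Integer as ℤ
open import Relation.Binary.PropositionalEquality using (_≡_)

open import Data.Nat.Base
open import Data.Nat.Properties
open import Data.Nat.Combinatorics
  using (k>n⇒nCk≡0; nCk≡n!/k![n-k]!; k![n∸k]!∣n!; nC1≡n; nCk+nC[k+1]≡[n+1]C[k+1])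
open import Data.Nat.Divisibility using (_∣_; divides; 0∣⇒≡0; *-monoʳ-∣)
open import Data.Nat.DivMod using (_/_; _%_; m/n<m; m*n%n≡0; m*n/n≡m; [m+kn]%n≡m%n; m*[n/m]≡n)
open import Data.Nat.Induction using (<-rec)
open import Data.Nat.Solver using (module +-*-Solver)
open import Data.Integer.Base using (+[1+_]; ∣_∣)
import Data.Integer.Properties as ℤ
open import Data.Integer.Solver using () renaming (module +-*-Solver to ℤ-Solver)
open import Data.Rational.Base using (ℚ)
import Data.Rational.Base as ℚ
import Data.Rational.Properties as ℚ
open import Data.Rational.Unnormalised.Base as ℚᵘ using (ℚᵘ; mkℚᵘ; _≃_; *≡*)
import Data.Rational.Unnormalised.Properties as ℚᵘ
open import Data.Fin.Base using (zero; suc; toℕ)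
open import Data.Vec.Functional using (Vector)
open import Data.List.Base using (map; applyUpTo)
open import Data.Product using (∃; _×_; _,_)
open import Data.Sum using (inj₁; inj₂)
open import Function.Base using (_∘_; id)
open import Relation.Binary.PropositionalEquality
open import Relation.Binary.Definitions using (tri<; tri≈; tri>)
open import Relation.Nullary using (contradiction; yes; no)

open import Algebra.Bundles using (AbelianGroup; CommutativeRing)
open import Algebra.Properties.CommutativeSemigroup *-commutativeSemigroup
  using () renaming (x∙yz≈y∙xz to x*[y*z]≡y*[x*z])
open import Algebra.Properties.CommutativeSemigroup +-commutativeSemigroup
  using () renaming (x∙yz≈y∙xz to x+[y+z]≡y+[x+z])
open import Algebra.Properties.Group (AbelianGroup.group ℤ.+-0-abelianGroup)
  using () renaming (∙-cancelˡ to ℤ-+-cancelˡ)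
open CommutativeRing ℚᵘ.+-*-commutativeRing using (commutativeSemiring; semiring)
open import Algebra.Properties.Semiring.Sum semiring
  using (sum; sum-syntax; sum⁺-syntax; sum-cong-≋; ∑-distrib-+; *-distribˡ-sum)
open import Algebra.Properties.Semiring.Exp semiring using () renaming (_^_ to _^ᵘ_)
open import Algebra.Properties.Semiring.Mult semiring using (×-congʳ) renaming (_×_ to _×ᵘ_)
open import Algebra.Properties.CommutativeSemiring.Binomial commutativeSemiring using (theorem)

-- The 2-adic valuation on ℕ

v₂ℕ-aux-fuel : ∀ {f g} n → n ≤ f → n ≤ g → v₂ℕ-aux f n ≡ v₂ℕ-aux g n
v₂ℕ-aux-fuel {zero}  {zero}  zero _ _ = refl
v₂ℕ-aux-fuel {zero}  {suc _} zero _ _ = refl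
v₂ℕ-aux-fuel {suc _} {zero}  zero _ _ = refl
v₂ℕ-aux-fuel {suc _} {suc _} zero _ _ = refl
v₂ℕ-aux-fuel {suc f} {suc g} (suc m) (s≤s m≤f) (s≤s m≤g) with suc m % 2
... | zero  = cong suc (v₂ℕ-aux-fuel (suc m / 2) (≤-trans half≤m m≤f) (≤-trans half≤m m≤g))
  where
  half≤m : suc m / 2 ≤ m
  half≤m = ≤-pred (m/n<m (suc m) 2 (s≤s (s≤s z≤n)))
... | suc _ = refl

v₂ℕ-double : ∀ n → .{{NonZero n}} → v₂ℕ (2 * n) ≡ suc (v₂ℕ n)
v₂ℕ-double n@(suc _) = begin
  v₂ℕ (2 * n)             ≡⟨ unfold-even _ (trans (cong (_% 2) (*-comm 2 n)) (m*n%n≡0 n 2)) ⟩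
  suc (v₂ℕ (2 * n / 2))   ≡⟨ cong (suc ∘ v₂ℕ) (trans (cong (_/ 2) (*-comm 2 n)) (m*n/n≡m n 2)) ⟩
  suc (v₂ℕ n)             ∎
  where
  open ≡-Reasoning
  unfold-even : ∀ m → suc m % 2 ≡ 0 → v₂ℕ (suc m) ≡ suc (v₂ℕ (suc m / 2))
  unfold-even m rem≡0 rewrite rem≡0 =
    cong suc (v₂ℕ-aux-fuel (suc m / 2) (≤-pred (m/n<m (suc m) 2 (s≤s (s≤s z≤n)))) ≤-refl)

v₂ℕ-odd : ∀ n → v₂ℕ (suc (2 * n)) ≡ 0
v₂ℕ-odd n = unfold-odd (2 * n) (trans (cong (λ m → suc m % 2) (*-comm 2 n)) ([m+kn]%n≡m%n 1 n 2))
  where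
  unfold-odd : ∀ m → suc m % 2 ≡ 1 → v₂ℕ (suc m) ≡ 0
  unfold-odd m rem≡1 rewrite rem≡1 = refl

v₂ℕ-2^n : ∀ n → v₂ℕ (2 ^ n) ≡ n
v₂ℕ-2^n zero    = refl
v₂ℕ-2^n (suc n) = trans (v₂ℕ-double (2 ^ n) {{m^n≢0 2 n}}) (cong suc (v₂ℕ-2^n n))

data EvenOdd : ℕ → Set where
  2*_   : ∀ m → EvenOdd (2 * m)
  1+2*_ : ∀ m → EvenOdd (suc (2 * m))

evenOdd : ∀ n → EvenOdd n
evenOdd zero = 2* 0
evenOdd (suc n) with evenOdd n
... | 2* m   = 1+2* m
... | 1+2* m = subst EvenOdd (*-suc 2 m) (2* suc m)

data TwoAdic : ℕ → Set where
  odd    : ∀ o → TwoAdic (suc (2 * o))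
  double : ∀ {n} → TwoAdic n → TwoAdic (2 * n)

twoAdic : ∀ n → .{{NonZero n}} → TwoAdic n
twoAdic = <-rec (λ n → .{{NonZero n}} → TwoAdic n) step
  where
  step : ∀ n → (∀ {m} → m < n → .{{NonZero m}} → TwoAdic m) → .{{NonZero n}} → TwoAdic n
  step n rec with evenOdd n
  ... | 1+2* m = odd m
  ... | 2* m@(suc _) = double (rec (m<m+n m (s≤s z≤n)))

ord : ∀ {n} → TwoAdic n → ℕ
ord (odd _)    = 0
ord (double d) = suc (ord d)

twoAdic⇒nonZero : ∀ {n} → TwoAdic n → NonZero n
twoAdic⇒nonZero (odd _)    = _
twoAdic⇒nonZero (double d) = m*n≢0 2 _ {{_}} {{twoAdic⇒nonZero d}}

v₂ℕ-ord : ∀ {n} (d : TwoAdic n) → v₂ℕ n ≡ ord d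
v₂ℕ-ord (odd o)        = v₂ℕ-odd o
v₂ℕ-ord (double {n} d) = trans (v₂ℕ-double n {{twoAdic⇒nonZero d}}) (cong suc (v₂ℕ-ord d))

private
  v₂ℕ-*-ord : ∀ {m n} (d : TwoAdic m) (e : TwoAdic n) → v₂ℕ (m * n) ≡ ord d + ord e
  v₂ℕ-*-ord (odd a) (odd b) = trans (cong v₂ℕ odd*odd) (v₂ℕ-odd (a + b + 2 * (a * b)))
    where
    open +-*-Solver
    odd*odd : suc (2 * a) * suc (2 * b) ≡ suc (2 * (a + b + 2 * (a * b)))
    odd*odd = solve 2 (λ a b → (con 1 :+ con 2 :* a) :* (con 1 :+ con 2 :* b)
                           := con 1 :+ con 2 :* (a :+ b :+ con 2 :* (a :* b))) refl a b
  v₂ℕ-*-ord (odd a) (double {n} e) = begin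
    v₂ℕ (suc (2 * a) * (2 * n))  ≡⟨ cong v₂ℕ (x*[y*z]≡y*[x*z] (suc (2 * a)) 2 n) ⟩
    v₂ℕ (2 * (suc (2 * a) * n))  ≡⟨ v₂ℕ-double (suc (2 * a) * n) {{m*n≢0 (suc (2 * a)) n {{_}} {{twoAdic⇒nonZero e}}}} ⟩
    suc (v₂ℕ (suc (2 * a) * n))  ≡⟨ cong suc (v₂ℕ-*-ord (odd a) e) ⟩
    suc (ord e)                  ∎
    where open ≡-Reasoning
  v₂ℕ-*-ord {_} {n} (double {m} d) e = begin
    v₂ℕ (2 * m * n)      ≡⟨ cong v₂ℕ (*-assoc 2 m n) ⟩
    v₂ℕ (2 * (m * n))    ≡⟨ v₂ℕ-double (m * n) {{m*n≢0 m n {{twoAdic⇒nonZero d}} {{twoAdic⇒nonZero e}}}} ⟩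
    suc (v₂ℕ (m * n))    ≡⟨ cong suc (v₂ℕ-*-ord d e) ⟩
    suc (ord d + ord e)  ∎
    where open ≡-Reasoning

  +-nonZeroˡ : ∀ {m} n → TwoAdic m → NonZero (m + n)
  +-nonZeroˡ {m} n d = >-nonZero (≤-trans (>-nonZero⁻¹ m {{twoAdic⇒nonZero d}}) (m≤m+n m n))

  v₂ℕ-+-<-ord : ∀ {m n} (d : TwoAdic m) (e : TwoAdic n) → ord d < ord e → v₂ℕ (m + n) ≡ ord d
  v₂ℕ-+-<-ord (odd a) (double {n} e) _ =
    trans (cong (v₂ℕ ∘ suc) (sym (*-distribˡ-+ 2 a n))) (v₂ℕ-odd (a + n))
  v₂ℕ-+-<-ord (double {m} d) (double {n} e) (s≤s ord-d<ord-e) = begin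
    v₂ℕ (2 * m + 2 * n)    ≡⟨ cong v₂ℕ (sym (*-distribˡ-+ 2 m n)) ⟩
    v₂ℕ (2 * (m + n))      ≡⟨ v₂ℕ-double (m + n) {{+-nonZeroˡ n d}} ⟩
    suc (v₂ℕ (m + n))      ≡⟨ cong suc (v₂ℕ-+-<-ord d e ord-d<ord-e) ⟩
    suc (ord d)            ∎
    where open ≡-Reasoning

  v₂ℕ-+-≡-ord : ∀ {m n} (d : TwoAdic m) (e : TwoAdic n) → ord d ≡ ord e → ord d < v₂ℕ (m + n)
  v₂ℕ-+-≡-ord (odd a) (odd b) _ = begin-strict
    0                              <⟨ s≤s z≤n ⟩
    suc (v₂ℕ (suc (a + b)))        ≡⟨ v₂ℕ-double (suc (a + b)) ⟨
    v₂ℕ (2 * suc (a + b))          ≡⟨ cong v₂ℕ odd+odd ⟨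
    v₂ℕ (suc (2 * a) + suc (2 * b)) ∎
    where
    open ≤-Reasoning
    open +-*-Solver
    odd+odd : suc (2 * a) + suc (2 * b) ≡ 2 * suc (a + b)
    odd+odd = solve 2 (λ a b → (con 1 :+ con 2 :* a) :+ (con 1 :+ con 2 :* b)
                            := con 2 :* (con 1 :+ (a :+ b))) refl a b
  v₂ℕ-+-≡-ord (double {m} d) (double {n} e) ord-d≡ord-e = begin-strict
    suc (ord d)            <⟨ s≤s (v₂ℕ-+-≡-ord d e (suc-injective ord-d≡ord-e)) ⟩
    suc (v₂ℕ (m + n))      ≡⟨ v₂ℕ-double (m + n) {{+-nonZeroˡ n d}} ⟨
    v₂ℕ (2 * (m + n))      ≡⟨ cong v₂ℕ (*-distribˡ-+ 2 m n) ⟩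
    v₂ℕ (2 * m + 2 * n)    ∎
    where open ≤-Reasoning

  v₂ℕ-between-ord : ∀ {m n} (d : TwoAdic m) (e : TwoAdic n) → m < n → ord d ≡ ord e →
                    ∃ λ w → m < w × w ≤ n × ord d < v₂ℕ w
  v₂ℕ-between-ord (odd a) (odd b) m<n _ = 2 * suc a , m<w , w≤n , v₂ℕ-w>0
    where
    m<w : suc (2 * a) < 2 * suc a
    m<w = subst (suc (2 * a) <_) (sym (*-suc 2 a)) ≤-refl
    w≤n : 2 * suc a ≤ suc (2 * b)
    w≤n = m≤n⇒m≤1+n (*-monoʳ-≤ 2 (*-cancelˡ-< 2 a b (≤-pred m<n)))
    v₂ℕ-w>0 : 0 < v₂ℕ (2 * suc a)
    v₂ℕ-w>0 = subst (0 <_) (sym (v₂ℕ-double (suc a))) (s≤s z≤n)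
  v₂ℕ-between-ord (double {m} d) (double {n} e) 2m<2n ord-d≡ord-e
    with v₂ℕ-between-ord d e (*-cancelˡ-< 2 m n 2m<2n) (suc-injective ord-d≡ord-e)
  ... | w , m<w , w≤n , ord-d<v₂ℕ-w =
    2 * w , *-monoʳ-< 2 m<w , *-monoʳ-≤ 2 w≤n ,
    subst (suc (ord d) <_) (sym (v₂ℕ-double w {{>-nonZero (≤-<-trans z≤n m<w)}})) (s≤s ord-d<v₂ℕ-w)

v₂ℕ-* : ∀ m n → .{{NonZero m}} → .{{NonZero n}} → v₂ℕ (m * n) ≡ v₂ℕ m + v₂ℕ n
v₂ℕ-* m n = trans (v₂ℕ-*-ord d e) (sym (cong₂ _+_ (v₂ℕ-ord d) (v₂ℕ-ord e)))
  where d = twoAdic m; e = twoAdic n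

v₂ℕ-+-< : ∀ m n → .{{NonZero m}} → .{{NonZero n}} → v₂ℕ m < v₂ℕ n → v₂ℕ (m + n) ≡ v₂ℕ m
v₂ℕ-+-< m n v₂ℕm<v₂ℕn = trans (v₂ℕ-+-<-ord d e (subst₂ _<_ (v₂ℕ-ord d) (v₂ℕ-ord e) v₂ℕm<v₂ℕn)) (sym (v₂ℕ-ord d))
  where d = twoAdic m; e = twoAdic n

v₂ℕ-+-≡ : ∀ m n → .{{NonZero m}} → .{{NonZero n}} → v₂ℕ m ≡ v₂ℕ n → v₂ℕ m < v₂ℕ (m + n)
v₂ℕ-+-≡ m n v₂ℕm≡v₂ℕn =
  subst (_< v₂ℕ (m + n)) (sym (v₂ℕ-ord d)) (v₂ℕ-+-≡-ord d e (subst₂ _≡_ (v₂ℕ-ord d) (v₂ℕ-ord e) v₂ℕm≡v₂ℕn))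
  where d = twoAdic m; e = twoAdic n

v₂ℕ-between : ∀ {m n} .{{_ : NonZero m}} → m < n → v₂ℕ m ≡ v₂ℕ n →
              ∃ λ w → m < w × w ≤ n × v₂ℕ m < v₂ℕ w
v₂ℕ-between {m} {n} m<n v₂ℕm≡v₂ℕn
  with v₂ℕ-between-ord d e m<n (subst₂ _≡_ (v₂ℕ-ord d) (v₂ℕ-ord e) v₂ℕm≡v₂ℕn)
  where d = twoAdic m; e = twoAdic n {{>-nonZero (≤-<-trans z≤n m<n)}}
... | w , m<w , w≤n , ord<v₂ℕw = w , m<w , w≤n , subst (_< v₂ℕ w) (sym (v₂ℕ-ord (twoAdic m))) ord<v₂ℕw

v₂ℕ-+-summand-< : ∀ m n → .{{NonZero m}} → .{{NonZero n}} → v₂ℕ m < v₂ℕ (m + n) → v₂ℕ n ≡ v₂ℕ m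
v₂ℕ-+-summand-< m n v₂ℕm<v₂ℕm+n with <-cmp (v₂ℕ m) (v₂ℕ n)
... | tri< v₂ℕm<v₂ℕn _ _ = contradiction (v₂ℕ-+-< m n v₂ℕm<v₂ℕn) (>⇒≢ v₂ℕm<v₂ℕm+n)
... | tri≈ _ v₂ℕm≡v₂ℕn _ = sym v₂ℕm≡v₂ℕn
... | tri> _ _ v₂ℕn<v₂ℕm = contradiction (subst (v₂ℕ m <_) v₂ℕm+n≡v₂ℕn v₂ℕm<v₂ℕm+n) (<-asym v₂ℕn<v₂ℕm)
  where
  v₂ℕm+n≡v₂ℕn : v₂ℕ (m + n) ≡ v₂ℕ n
  v₂ℕm+n≡v₂ℕn = trans (cong v₂ℕ (+-comm m n)) (v₂ℕ-+-< n m v₂ℕn<v₂ℕm)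

v₂ℕ-+-summand-> : ∀ m n → .{{NonZero m}} → .{{NonZero n}} → v₂ℕ (m + n) < v₂ℕ m → v₂ℕ n ≡ v₂ℕ (m + n)
v₂ℕ-+-summand-> m n v₂ℕm+n<v₂ℕm with <-cmp (v₂ℕ m) (v₂ℕ n)
... | tri< v₂ℕm<v₂ℕn _ _ = contradiction (v₂ℕ-+-< m n v₂ℕm<v₂ℕn) (<⇒≢ v₂ℕm+n<v₂ℕm)
... | tri≈ _ v₂ℕm≡v₂ℕn _ = contradiction (v₂ℕ-+-≡ m n v₂ℕm≡v₂ℕn) (<⇒≯ v₂ℕm+n<v₂ℕm)
... | tri> _ _ v₂ℕn<v₂ℕm = sym (trans (cong v₂ℕ (+-comm m n)) (v₂ℕ-+-< n m v₂ℕn<v₂ℕm))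

-- Factorials and binomial coefficients

v₂ℕ-[2n]! : ∀ n → v₂ℕ ((2 * n) !) ≡ n + v₂ℕ (n !)
v₂ℕ-[2n]! zero = refl
v₂ℕ-[2n]! (suc n) = begin
  v₂ℕ ((2 * suc n) !)                                  ≡⟨ cong (v₂ℕ ∘ _!) (*-suc 2 n) ⟩
  v₂ℕ ((2 + 2 * n) * ((1 + 2 * n) * (2 * n) !))         ≡⟨ v₂ℕ-* (2 + 2 * n) _ ⟩
  v₂ℕ (2 + 2 * n) + v₂ℕ ((1 + 2 * n) * (2 * n) !)       ≡⟨ cong₂ _+_ v₂ℕ[2+2n] (v₂ℕ-* (1 + 2 * n) _) ⟩
  suc (v₂ℕ (suc n)) + (v₂ℕ (1 + 2 * n) + v₂ℕ ((2 * n) !)) ≡⟨ cong (λ k → suc (v₂ℕ (suc n)) + (k + v₂ℕ ((2 * n) !))) (v₂ℕ-odd n) ⟩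
  suc (v₂ℕ (suc n)) + v₂ℕ ((2 * n) !)                  ≡⟨ cong (λ k → suc (v₂ℕ (suc n)) + k) (v₂ℕ-[2n]! n) ⟩
  suc (v₂ℕ (suc n)) + (n + v₂ℕ (n !))                  ≡⟨ cong suc (x+[y+z]≡y+[x+z] (v₂ℕ (suc n)) n (v₂ℕ (n !))) ⟩
  suc n + (v₂ℕ (suc n) + v₂ℕ (n !))                    ≡⟨ cong (λ k → suc n + k) (v₂ℕ-* (suc n) (n !)) ⟨
  suc n + v₂ℕ (suc n !)                                ∎
  where
  open ≡-Reasoning
  v₂ℕ[2+2n] : v₂ℕ (2 + 2 * n) ≡ suc (v₂ℕ (suc n))
  v₂ℕ[2+2n] = trans (cong v₂ℕ (sym (*-suc 2 n))) (v₂ℕ-double (suc n))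
  instance
    _ = n !≢0
    _ = (2 * n) !≢0
    _ = m*n≢0 (1 + 2 * n) ((2 * n) !)

v₂ℕ-!< : ∀ n → .{{NonZero n}} → v₂ℕ (n !) < n
v₂ℕ-!< = <-rec (λ n → .{{NonZero n}} → v₂ℕ (n !) < n) step
  where
  step : ∀ n → (∀ {m} → m < n → .{{NonZero m}} → v₂ℕ (m !) < m) → .{{NonZero n}} → v₂ℕ (n !) < n
  step n rec with evenOdd n
  ... | 2* m@(suc _) = begin-strict
    v₂ℕ ((2 * m) !)  ≡⟨ v₂ℕ-[2n]! m ⟩
    m + v₂ℕ (m !)    <⟨ +-monoʳ-< m (rec (m<m+n m (s≤s z≤n))) ⟩
    m + m            ≡⟨ cong (λ k → m + k) (+-identityʳ m) ⟨
    2 * m            ∎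
    where open ≤-Reasoning
  ... | 1+2* zero = s≤s z≤n
  ... | 1+2* m@(suc _) = begin-strict
    v₂ℕ (suc (2 * m) * (2 * m) !)         ≡⟨ v₂ℕ-* (suc (2 * m)) ((2 * m) !) {{_}} {{(2 * m) !≢0}} ⟩
    v₂ℕ (suc (2 * m)) + v₂ℕ ((2 * m) !)   ≡⟨ cong (_+ v₂ℕ ((2 * m) !)) (v₂ℕ-odd m) ⟩
    v₂ℕ ((2 * m) !)                       <⟨ m<n⇒m<1+n (rec (n<1+n (2 * m))) ⟩
    suc (2 * m)                           ∎
    where open ≤-Reasoning

v₂ℕ-mono-∣ : ∀ {m n} .{{_ : NonZero n}} → m ∣ n → v₂ℕ m ≤ v₂ℕ n
v₂ℕ-mono-∣ {m} (divides k refl) =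
  subst (v₂ℕ m ≤_) (sym (v₂ℕ-* k m {{m*n≢0⇒m≢0 k}} {{m*n≢0⇒n≢0 k}})) (m≤n+m (v₂ℕ m) (v₂ℕ k))

nCk∣n! : ∀ {n k} → k ≤ n → n C k ∣ n !
nCk∣n! {n} {k} k≤n = divides (k ! * (n ∸ k) !) (sym (begin
  k ! * (n ∸ k) ! * (n C k)                         ≡⟨ cong (k ! * (n ∸ k) ! *_) (nCk≡n!/k![n-k]! k≤n) ⟩
  k ! * (n ∸ k) ! * (n ! / (k ! * (n ∸ k) !))       ≡⟨ m*[n/m]≡n (k![n∸k]!∣n! k≤n) ⟩
  n !                                               ∎))
  where
  open ≡-Reasoning
  instance _ = k !* (n ∸ k) !≢0

nCk≢0 : ∀ {n k} → k ≤ n → NonZero (n C k)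
nCk≢0 {n} {k} k≤n = ≢-nonZero λ nCk≡0 → ≢-nonZero⁻¹ (n !) {{n !≢0}} (0∣⇒≡0 (subst (_∣ n !) nCk≡0 (nCk∣n! k≤n)))

v₂ℕ-[1+n]*nCk≤n : ∀ {n k} → k ≤ n → v₂ℕ (suc n * (n C k)) ≤ n
v₂ℕ-[1+n]*nCk≤n {n} k≤n = ≤-pred (≤-<-trans
  (v₂ℕ-mono-∣ {{suc n !≢0}} (*-monoʳ-∣ (suc n) (nCk∣n! k≤n))) (v₂ℕ-!< (suc n)))

[k+1]*[n+1]C[k+1]≡[n+1]*nCk : ∀ n k → suc k * (suc n C suc k) ≡ suc n * (n C k)
[k+1]*[n+1]C[k+1]≡[n+1]*nCk zero    zero    = refl
[k+1]*[n+1]C[k+1]≡[n+1]*nCk zero    (suc k) = *-zeroʳ (2 + k)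
[k+1]*[n+1]C[k+1]≡[n+1]*nCk (suc n) zero    = trans (*-identityˡ _) (trans (nC1≡n (2 + n)) (sym (*-identityʳ (2 + n))))
[k+1]*[n+1]C[k+1]≡[n+1]*nCk (suc n) (suc k) = begin
  (2 + k) * ((2 + n) C (2 + k))                        ≡⟨ cong ((2 + k) *_) (nCk+nC[k+1]≡[n+1]C[k+1] (suc n) (suc k)) ⟨
  (2 + k) * (A + B)                                    ≡⟨ solve 3 (λ k A B → (con 2 :+ k) :* (A :+ B) := A :+ (con 1 :+ k) :* A :+ (con 2 :+ k) :* B) refl k A B ⟩
  A + (1 + k) * A + (2 + k) * B                        ≡⟨ cong₂ (λ x y → A + x + y) ([k+1]*[n+1]C[k+1]≡[n+1]*nCk n k) ([k+1]*[n+1]C[k+1]≡[n+1]*nCk n (suc k)) ⟩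
  A + (1 + n) * (n C k) + (1 + n) * (n C (1 + k))      ≡⟨ solve 4 (λ a n x y → a :+ (con 1 :+ n) :* x :+ (con 1 :+ n) :* y := a :+ (con 1 :+ n) :* (x :+ y)) refl A n (n C k) (n C suc k) ⟩
  A + (1 + n) * (n C k + n C (1 + k))                  ≡⟨ cong (λ x → A + (1 + n) * x) (nCk+nC[k+1]≡[n+1]C[k+1] n k) ⟩
  A + (1 + n) * A                                      ∎
  where
  open ≡-Reasoning
  open +-*-Solver
  A = suc n C suc k
  B = suc n C suc (suc k)

[n+1]*nCk+k*[n+1]Ck≡[n+1]*[n+1]Ck : ∀ n k → suc n * (n C k) + k * (suc n C k) ≡ suc n * (suc n C k)
[n+1]*nCk+k*[n+1]Ck≡[n+1]*[n+1]Ck n zero    = +-identityʳ _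
[n+1]*nCk+k*[n+1]Ck≡[n+1]*[n+1]Ck n (suc k) = begin
  suc n * (n C suc k) + suc k * (suc n C suc k)   ≡⟨ cong (λ x → suc n * (n C suc k) + x) ([k+1]*[n+1]C[k+1]≡[n+1]*nCk n k) ⟩
  suc n * (n C suc k) + suc n * (n C k)           ≡⟨ trans (+-comm (suc n * (n C suc k)) _) (sym (*-distribˡ-+ (suc n) (n C k) (n C suc k))) ⟩
  suc n * (n C k + n C suc k)                     ≡⟨ cong (suc n *_) (nCk+nC[k+1]≡[n+1]C[k+1] n k) ⟩
  suc n * (suc n C suc k)                         ∎
  where open ≡-Reasoning

-- The 2-adic valuation of positive rationals

v₂[_/_] : ℕ → ℕ → ℤ
v₂[ m / n ] = + v₂ℕ m ℤ.- + v₂ℕ n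

v₂[*/*]≡v₂[/]+v₂[/] : ∀ a b c d → .{{NonZero a}} → .{{NonZero b}} → .{{NonZero c}} → .{{NonZero d}} →
                      v₂[ a * c / b * d ] ≡ v₂[ a / b ] ℤ.+ v₂[ c / d ]
v₂[*/*]≡v₂[/]+v₂[/] a b c d = begin
  + v₂ℕ (a * c) ℤ.- + v₂ℕ (b * d)                   ≡⟨ cong₂ (λ x y → + x ℤ.- + y) (v₂ℕ-* a c) (v₂ℕ-* b d) ⟩
  + (v₂ℕ a + v₂ℕ c) ℤ.- + (v₂ℕ b + v₂ℕ d)           ≡⟨ cong₂ ℤ._-_ (ℤ.pos-+ (v₂ℕ a) (v₂ℕ c)) (ℤ.pos-+ (v₂ℕ b) (v₂ℕ d)) ⟩
  (+ v₂ℕ a ℤ.+ + v₂ℕ c) ℤ.- (+ v₂ℕ b ℤ.+ + v₂ℕ d)   ≡⟨ solve 4 (λ a b c d → (a :+ c) :- (b :+ d) := (a :- b) :+ (c :- d)) refl (+ v₂ℕ a) (+ v₂ℕ b) (+ v₂ℕ c) (+ v₂ℕ d) ⟩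
  v₂[ a / b ] ℤ.+ v₂[ c / d ]                       ∎
  where
  open ≡-Reasoning
  open ℤ-Solver

v₂[*/*]≡v₂[/] : ∀ m n k → .{{NonZero m}} → .{{NonZero n}} → .{{NonZero k}} →
                v₂[ m * k / n * k ] ≡ v₂[ m / n ]
v₂[*/*]≡v₂[/] m n k = begin
  v₂[ m * k / n * k ]                 ≡⟨ v₂[*/*]≡v₂[/]+v₂[/] m n k k ⟩
  v₂[ m / n ] ℤ.+ v₂[ k / k ]         ≡⟨ cong (λ z → v₂[ m / n ] ℤ.+ z) (ℤ.+-inverseʳ (+ v₂ℕ k)) ⟩
  v₂[ m / n ] ℤ.+ + 0                 ≡⟨ ℤ.+-identityʳ v₂[ m / n ] ⟩
  v₂[ m / n ]                         ∎
  where open ≡-Reasoning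

v₂[/]-cancelʳ-< : ∀ {m n k} → v₂[ m / k ] ℤ.< v₂[ n / k ] → v₂ℕ m < v₂ℕ n
v₂[/]-cancelʳ-< {m} {n} {k} lt with v₂ℕ m <? v₂ℕ n
... | yes v₂ℕm<v₂ℕn = v₂ℕm<v₂ℕn
... | no  v₂ℕm≮v₂ℕn = contradiction lt (ℤ.≤⇒≯ (ℤ.+-monoˡ-≤ (ℤ.- + v₂ℕ k) (ℤ.+≤+ (≮⇒≥ v₂ℕm≮v₂ℕn))))

v₂ᵘ : ℚᵘ → ℤ
v₂ᵘ (mkℚᵘ n d) = v₂[ ∣ n ∣ / suc d ]

v₂ᵘ-cong : ∀ {x y} .{{_ : ℚᵘ.Positive x}} → x ≃ y → v₂ᵘ x ≡ v₂ᵘ y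
v₂ᵘ-cong {mkℚᵘ +[1+ a ] b} {mkℚᵘ n d} (*≡* eq) = begin
  v₂[ A / B ]             ≡⟨ v₂[*/*]≡v₂[/] A B D ⟨
  v₂[ A * D / B * D ]     ≡⟨ cong v₂[_/ B * D ] A*D≡N*B ⟩
  v₂[ N * B / B * D ]     ≡⟨ cong v₂[ N * B /_] (*-comm B D) ⟩
  v₂[ N * B / D * B ]     ≡⟨ v₂[*/*]≡v₂[/] N D B ⟩
  v₂[ N / D ]             ∎
  where
  open ≡-Reasoning
  A = suc a; B = suc b; D = suc d; N = ∣ n ∣
  A*D≡N*B : A * D ≡ N * B
  A*D≡N*B = trans (cong ∣_∣ eq) (ℤ.abs-* n (+ B))
  instance
    _ : NonZero N
    _ = m*n≢0⇒m≢0 N {{subst NonZero A*D≡N*B _}}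

v₂ᵘ-* : ∀ x y → .{{ℚᵘ.Positive x}} → .{{ℚᵘ.Positive y}} → v₂ᵘ (x ℚᵘ.* y) ≡ v₂ᵘ x ℤ.+ v₂ᵘ y
v₂ᵘ-* (mkℚᵘ +[1+ a ] b) (mkℚᵘ +[1+ c ] d) = v₂[*/*]≡v₂[/]+v₂[/] (suc a) (suc b) (suc c) (suc d)

v₂ᵘ-+-< : ∀ x y → .{{ℚᵘ.Positive x}} → .{{ℚᵘ.Positive y}} → v₂ᵘ x ℤ.< v₂ᵘ y → v₂ᵘ (x ℚᵘ.+ y) ≡ v₂ᵘ x
v₂ᵘ-+-< (mkℚᵘ +[1+ a ] b) (mkℚᵘ +[1+ c ] d) v₂ᵘx<v₂ᵘy = begin
  v₂[ A * B′ + A′ * B / B * B′ ]   ≡⟨ cong (λ k → + k ℤ.- + v₂ℕ (B * B′)) (v₂ℕ-+-< (A * B′) (A′ * B) v₂ℕ[A*B′]<v₂ℕ[A′*B]) ⟩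
  v₂[ A * B′ / B * B′ ]           ≡⟨ v₂[*/*]≡v₂[/] A B B′ ⟩
  v₂[ A / B ]                   ∎
  where
  open ≡-Reasoning
  A = suc a; B = suc b; A′ = suc c; B′ = suc d
  v₂ℕ[A*B′]<v₂ℕ[A′*B] : v₂ℕ (A * B′) < v₂ℕ (A′ * B)
  v₂ℕ[A*B′]<v₂ℕ[A′*B] = v₂[/]-cancelʳ-< {k = B * B′} (subst₂ ℤ._<_
    (sym (v₂[*/*]≡v₂[/] A B B′))
    (sym (trans (cong v₂[ A′ * B /_] (*-comm B B′)) (v₂[*/*]≡v₂[/] A′ B′ B))) v₂ᵘx<v₂ᵘy)

v₂ᵘ-+-summand-< : ∀ x y → .{{ℚᵘ.Positive x}} → .{{ℚᵘ.Positive y}} → v₂ᵘ x ℤ.< v₂ᵘ (x ℚᵘ.+ y) → v₂ᵘ y ≡ v₂ᵘ x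
v₂ᵘ-+-summand-< x y v₂ᵘx<v₂ᵘ[x+y] with ℤ.<-cmp (v₂ᵘ x) (v₂ᵘ y)
... | tri< v₂ᵘx<v₂ᵘy _ _ = contradiction (v₂ᵘ-+-< x y v₂ᵘx<v₂ᵘy) (≢-sym (ℤ.<⇒≢ v₂ᵘx<v₂ᵘ[x+y]))
... | tri≈ _ v₂ᵘx≡v₂ᵘy _ = sym v₂ᵘx≡v₂ᵘy
... | tri> _ _ v₂ᵘy<v₂ᵘx = contradiction (subst (v₂ᵘ x ℤ.<_) v₂ᵘ[x+y]≡v₂ᵘy v₂ᵘx<v₂ᵘ[x+y]) (ℤ.<-asym v₂ᵘy<v₂ᵘx)
  where
  v₂ᵘ[x+y]≡v₂ᵘy : v₂ᵘ (x ℚᵘ.+ y) ≡ v₂ᵘ y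
  v₂ᵘ[x+y]≡v₂ᵘy = trans (v₂ᵘ-cong {{ℚᵘ.pos+pos⇒pos x y}} (ℚᵘ.+-comm x y)) (v₂ᵘ-+-< y x v₂ᵘy<v₂ᵘx)

fracᵘ : ℕ → ℕ → ℚᵘ
fracᵘ m zero    = ℚᵘ.0ℚᵘ
fracᵘ m (suc d) = mkℚᵘ (+ m) d

fracᵘ-positive : ∀ m d → .{{NonZero m}} → .{{NonZero d}} → ℚᵘ.Positive (fracᵘ m d)
fracᵘ-positive (suc m) (suc d) = _

fracᵘ-≃ : ∀ {m n d e} → .{{NonZero d}} → .{{NonZero e}} → m * e ≡ n * d → fracᵘ m d ≃ fracᵘ n e
fracᵘ-≃ {m} {n} {suc d} {suc e} m*e≡n*d = *≡* (begin
  + m ℤ.* + suc e   ≡⟨ ℤ.pos-* m (suc e) ⟨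
  + (m * suc e)     ≡⟨ cong +_ m*e≡n*d ⟩
  + (n * suc d)     ≡⟨ ℤ.pos-* n (suc d) ⟩
  + n ℤ.* + suc d   ∎)
  where open ≡-Reasoning

fracᵘ-+ : ∀ m n d e → .{{NonZero d}} → .{{NonZero e}} → fracᵘ m d ℚᵘ.+ fracᵘ n e ≡ fracᵘ (m * e + n * d) (d * e)
fracᵘ-+ m n (suc d) (suc e) = cong (λ k → mkℚᵘ k (e + d * suc e)) (begin
  + m ℤ.* + suc e ℤ.+ + n ℤ.* + suc d   ≡⟨ cong₂ ℤ._+_ (ℤ.pos-* m (suc e)) (ℤ.pos-* n (suc d)) ⟨
  + (m * suc e) ℤ.+ + (n * suc d)       ≡⟨ ℤ.pos-+ (m * suc e) (n * suc d) ⟨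
  + (m * suc e + n * suc d)             ∎)
  where open ≡-Reasoning

fracᵘ-* : ∀ m n d e → .{{NonZero d}} → .{{NonZero e}} → fracᵘ m d ℚᵘ.* fracᵘ n e ≡ fracᵘ (m * n) (d * e)
fracᵘ-* m n (suc d) (suc e) = cong (λ k → mkℚᵘ k (e + d * suc e)) (sym (ℤ.pos-* m n))

fracᵘ-+-same : ∀ m n d → .{{NonZero d}} → fracᵘ m d ℚᵘ.+ fracᵘ n d ≃ fracᵘ (m + n) d
fracᵘ-+-same m n d = ℚᵘ.≃-trans (ℚᵘ.≃-reflexive (fracᵘ-+ m n d d)) (fracᵘ-≃ {{m*n≢0 d d}}
  (solve 3 (λ m n d → (m :* d :+ n :* d) :* d := (m :+ n) :* (d :* d)) refl m n d))
  where open +-*-Solver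

fracᵘ-*ˡ : ∀ m n d → .{{NonZero d}} → fracᵘ m 1 ℚᵘ.* fracᵘ n d ≃ fracᵘ (m * n) d
fracᵘ-*ˡ m n d = ℚᵘ.≃-reflexive (trans (fracᵘ-* m n 1 d) (cong (fracᵘ (m * n)) (*-identityˡ d)))

fracᵘ-cancel : ∀ m d → .{{NonZero d}} → fracᵘ (d * m) d ≃ fracᵘ m 1
fracᵘ-cancel m d = fracᵘ-≃ (trans (*-identityʳ (d * m)) (*-comm d m))

fracᵘ-zero : ∀ d → fracᵘ 0 d ≃ ℚᵘ.0ℚᵘ
fracᵘ-zero zero    = ℚᵘ.≃-refl
fracᵘ-zero (suc d) = *≡* refl

v₂ᵘ-fracᵘ : ∀ m d → .{{NonZero d}} → v₂ᵘ (fracᵘ m d) ≡ v₂[ m / d ]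
v₂ᵘ-fracᵘ m (suc d) = refl

v₂ᵘ-fracᵘ-1 : ∀ m → v₂ᵘ (fracᵘ m 1) ≡ + v₂ℕ m
v₂ᵘ-fracᵘ-1 m = ℤ.+-identityʳ (+ v₂ℕ m)

v₂ᵘ-fracᵘ-* : ∀ m n d → .{{NonZero m}} → .{{NonZero n}} → .{{NonZero d}} →
              v₂ᵘ (fracᵘ (m * n) d) ≡ + v₂ℕ m ℤ.+ v₂ᵘ (fracᵘ n d)
v₂ᵘ-fracᵘ-* m n (suc d) = begin
  + v₂ℕ (m * n) ℤ.- + v₂ℕ (suc d)             ≡⟨ cong (λ k → + k ℤ.- + v₂ℕ (suc d)) (v₂ℕ-* m n) ⟩
  + (v₂ℕ m + v₂ℕ n) ℤ.- + v₂ℕ (suc d)         ≡⟨ cong (ℤ._- + v₂ℕ (suc d)) (ℤ.pos-+ (v₂ℕ m) (v₂ℕ n)) ⟩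
  + v₂ℕ m ℤ.+ + v₂ℕ n ℤ.- + v₂ℕ (suc d)       ≡⟨ ℤ.+-assoc (+ v₂ℕ m) (+ v₂ℕ n) (ℤ.- + v₂ℕ (suc d)) ⟩
  + v₂ℕ m ℤ.+ (+ v₂ℕ n ℤ.- + v₂ℕ (suc d))     ∎
  where open ≡-Reasoning

-- The sums S(p, q) and their recurrences

1ᵘ^n≃1ᵘ : ∀ n → ℚᵘ.1ℚᵘ ^ᵘ n ≃ ℚᵘ.1ℚᵘ
1ᵘ^n≃1ᵘ zero    = ℚᵘ.≃-refl
1ᵘ^n≃1ᵘ (suc n) = ℚᵘ.≃-trans (ℚᵘ.*-identityˡ (ℚᵘ.1ℚᵘ ^ᵘ n)) (1ᵘ^n≃1ᵘ n)

n×ᵘ1ᵘ≃fracᵘ[n,1] : ∀ n → n ×ᵘ ℚᵘ.1ℚᵘ ≃ fracᵘ n 1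
n×ᵘ1ᵘ≃fracᵘ[n,1] zero    = ℚᵘ.≃-refl
n×ᵘ1ᵘ≃fracᵘ[n,1] (suc n) = ℚᵘ.≃-trans (ℚᵘ.+-congʳ ℚᵘ.1ℚᵘ (n×ᵘ1ᵘ≃fracᵘ[n,1] n)) (fracᵘ-+-same 1 n 1)

[1ᵘ+1ᵘ]^n≃fracᵘ[2^n,1] : ∀ n → (ℚᵘ.1ℚᵘ ℚᵘ.+ ℚᵘ.1ℚᵘ) ^ᵘ n ≃ fracᵘ (2 ^ n) 1
[1ᵘ+1ᵘ]^n≃fracᵘ[2^n,1] zero    = ℚᵘ.≃-refl
[1ᵘ+1ᵘ]^n≃fracᵘ[2^n,1] (suc n) = ℚᵘ.≃-trans (ℚᵘ.*-congˡ {fracᵘ 2 1} ([1ᵘ+1ᵘ]^n≃fracᵘ[2^n,1] n)) (fracᵘ-*ˡ 2 (2 ^ n) 1)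

∑fracᵘ[nCk,1]≃fracᵘ[2^n,1] : ∀ n → ∑[ k ≤ n ] fracᵘ (n C toℕ k) 1 ≃ fracᵘ (2 ^ n) 1
∑fracᵘ[nCk,1]≃fracᵘ[2^n,1] n = begin
  ∑[ k ≤ n ] fracᵘ (n C toℕ k) 1                               ≈⟨ sum-cong-≋ {suc n} binomialTerm≃ ⟨
  ∑[ k ≤ n ] ((n C toℕ k) ×ᵘ (1ᵘ ^ᵘ toℕ k ℚᵘ.* 1ᵘ ^ᵘ (n ∸ toℕ k))) ≈⟨ theorem n 1ᵘ 1ᵘ ⟨
  (1ᵘ ℚᵘ.+ 1ᵘ) ^ᵘ n                                            ≈⟨ [1ᵘ+1ᵘ]^n≃fracᵘ[2^n,1] n ⟩
  fracᵘ (2 ^ n) 1                                              ∎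
  where
  open ℚᵘ.≃-Reasoning
  1ᵘ = ℚᵘ.1ℚᵘ
  binomialTerm≃ : ∀ k → (n C toℕ k) ×ᵘ (1ᵘ ^ᵘ toℕ k ℚᵘ.* 1ᵘ ^ᵘ (n ∸ toℕ k)) ≃ fracᵘ (n C toℕ k) 1
  binomialTerm≃ k = ℚᵘ.≃-trans
    (×-congʳ (n C toℕ k) (ℚᵘ.≃-trans (ℚᵘ.*-cong (1ᵘ^n≃1ᵘ (toℕ k)) (1ᵘ^n≃1ᵘ (n ∸ toℕ k))) (ℚᵘ.*-identityˡ 1ᵘ)))
    (n×ᵘ1ᵘ≃fracᵘ[n,1] (n C toℕ k))

Sᵘ : ℕ → ℕ → ℚᵘ
Sᵘ p q = ∑[ i ≤ q ] fracᵘ (q C toℕ i) (p + toℕ i)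

sum-nonNegative : ∀ {n} (f : Vector ℚᵘ n) → (∀ i → ℚᵘ.NonNegative (f i)) → ℚᵘ.NonNegative (sum f)
sum-nonNegative {zero}  f f≥0 = _
sum-nonNegative {suc n} f f≥0 =
  ℚᵘ.nonNeg+nonNeg⇒nonNeg (f zero) {{f≥0 zero}} (sum (f ∘ suc)) {{sum-nonNegative (f ∘ suc) (f≥0 ∘ suc)}}

fracᵘ-nonNegative : ∀ m d → ℚᵘ.NonNegative (fracᵘ m d)
fracᵘ-nonNegative m zero    = _
fracᵘ-nonNegative m (suc d) = _

Sᵘ-positive : ∀ p q → .{{NonZero p}} → ℚᵘ.Positive (Sᵘ p q)
Sᵘ-positive p@(suc _) q = ℚᵘ.positive (ℚᵘ.<-≤-trans (ℚᵘ.positive⁻¹ first)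
  (ℚᵘ.p≤p+q first (sum rest) {{sum-nonNegative rest (λ i → fracᵘ-nonNegative (q C suc (toℕ i)) (p + suc (toℕ i)))}}))
  where
  first = fracᵘ 1 (p + 0)
  rest : Vector ℚᵘ q
  rest i = fracᵘ (q C suc (toℕ i)) (p + suc (toℕ i))

sum-drop-last : ∀ n (f : ℕ → ℚᵘ) → f n ≃ ℚᵘ.0ℚᵘ → ∑[ i ≤ n ] f (toℕ i) ≃ ∑[ i < n ] f (toℕ i)
sum-drop-last zero    f f0≃0 = ℚᵘ.≃-trans (ℚᵘ.+-identityʳ (f 0)) f0≃0
sum-drop-last (suc n) f fn≃0 = ℚᵘ.+-congʳ (f 0) (sum-drop-last n (f ∘ suc) fn≃0)

[p+q+1]*[q+1]Ci/[p+i]≃[q+1]Ci+[q+1]*qCi/[p+i] : ∀ p q → .{{NonZero p}} → ∀ i →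
  fracᵘ (p + suc q) 1 ℚᵘ.* fracᵘ (suc q C i) (p + i) ≃
  fracᵘ (suc q C i) 1 ℚᵘ.+ fracᵘ (suc q) 1 ℚᵘ.* fracᵘ (q C i) (p + i)
[p+q+1]*[q+1]Ci/[p+i]≃[q+1]Ci+[q+1]*qCi/[p+i] p@(suc _) q i = begin
  fracᵘ (p + suc q) 1 ℚᵘ.* fracᵘ C₁ (p + i)                    ≈⟨ fracᵘ-*ˡ (p + suc q) C₁ (p + i) ⟩
  fracᵘ ((p + suc q) * C₁) (p + i)                             ≡⟨ cong (λ c → fracᵘ c (p + i)) numerator≡ ⟩
  fracᵘ ((p + i) * C₁ + suc q * C₀) (p + i)                    ≈⟨ fracᵘ-+-same ((p + i) * C₁) (suc q * C₀) (p + i) ⟨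
  fracᵘ ((p + i) * C₁) (p + i) ℚᵘ.+ fracᵘ (suc q * C₀) (p + i)
    ≈⟨ ℚᵘ.+-cong (fracᵘ-cancel C₁ (p + i)) (ℚᵘ.≃-sym (fracᵘ-*ˡ (suc q) C₀ (p + i))) ⟩
  fracᵘ C₁ 1 ℚᵘ.+ fracᵘ (suc q) 1 ℚᵘ.* fracᵘ C₀ (p + i)        ∎
  where
  open ℚᵘ.≃-Reasoning
  C₀ = q C i
  C₁ = suc q C i
  numerator≡ : (p + suc q) * C₁ ≡ (p + i) * C₁ + suc q * C₀
  numerator≡ = trans (*-distribʳ-+ C₁ p (suc q)) (trans
    (cong (λ x → p * C₁ + x) (sym ([n+1]*nCk+k*[n+1]Ck≡[n+1]*[n+1]Ck q i)))
    (solve 5 (λ p q i C₀ C₁ → p :* C₁ :+ ((con 1 :+ q) :* C₀ :+ i :* C₁) := (p :+ i) :* C₁ :+ (con 1 :+ q) :* C₀)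
           refl p q i C₀ C₁))
    where open +-*-Solver

[p+q+1]*Sᵘ[p,q+1]≃2^[q+1]+[q+1]*Sᵘ[p,q] : ∀ p q → .{{NonZero p}} →
  fracᵘ (p + suc q) 1 ℚᵘ.* Sᵘ p (suc q) ≃ fracᵘ (2 ^ suc q) 1 ℚᵘ.+ fracᵘ (suc q) 1 ℚᵘ.* Sᵘ p q
[p+q+1]*Sᵘ[p,q+1]≃2^[q+1]+[q+1]*Sᵘ[p,q] p@(suc _) q = begin
  N ℚᵘ.* ∑[ i ≤ suc q ] a (toℕ i)                               ≈⟨ *-distribˡ-sum {suc (suc q)} N (a ∘ toℕ) ⟩
  ∑[ i ≤ suc q ] (N ℚᵘ.* a (toℕ i))
    ≈⟨ sum-cong-≋ {suc (suc q)} ([p+q+1]*[q+1]Ci/[p+i]≃[q+1]Ci+[q+1]*qCi/[p+i] p q ∘ toℕ) ⟩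
  ∑[ i ≤ suc q ] (fracᵘ (suc q C toℕ i) 1 ℚᵘ.+ Q ℚᵘ.* b (toℕ i))
    ≈⟨ ∑-distrib-+ {suc (suc q)} (λ i → fracᵘ (suc q C toℕ i) 1) (λ i → Q ℚᵘ.* b (toℕ i)) ⟩
  ∑[ i ≤ suc q ] fracᵘ (suc q C toℕ i) 1 ℚᵘ.+ ∑[ i ≤ suc q ] (Q ℚᵘ.* b (toℕ i))
    ≈⟨ ℚᵘ.+-cong (∑fracᵘ[nCk,1]≃fracᵘ[2^n,1] (suc q)) (ℚᵘ.≃-sym (*-distribˡ-sum {suc (suc q)} Q (b ∘ toℕ))) ⟩
  fracᵘ (2 ^ suc q) 1 ℚᵘ.+ Q ℚᵘ.* ∑[ i ≤ suc q ] b (toℕ i)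
    ≈⟨ ℚᵘ.+-congʳ (fracᵘ (2 ^ suc q) 1) (ℚᵘ.*-congˡ {Q} (sum-drop-last (suc q) b b[q+1]≃0)) ⟩
  fracᵘ (2 ^ suc q) 1 ℚᵘ.+ Q ℚᵘ.* Sᵘ p q                         ∎
  where
  open ℚᵘ.≃-Reasoning
  N = fracᵘ (p + suc q) 1
  Q = fracᵘ (suc q) 1
  a b : ℕ → ℚᵘ
  a i = fracᵘ (suc q C i) (p + i)
  b i = fracᵘ (q C i) (p + i)
  b[q+1]≃0 : b (suc q) ≃ ℚᵘ.0ℚᵘ
  b[q+1]≃0 = ℚᵘ.≃-trans (ℚᵘ.≃-reflexive (cong (λ c → fracᵘ c (p + suc q)) (k>n⇒nCk≡0 (n<1+n q))))
                        (fracᵘ-zero (p + suc q))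

p*[q+1]C[i+1]/[p+i+1]+[q+1]*qCi/[p+i+1]≃[q+1]C[i+1] : ∀ p q → .{{NonZero p}} → ∀ i →
  fracᵘ p 1 ℚᵘ.* fracᵘ (suc q C suc i) (p + suc i) ℚᵘ.+ fracᵘ (suc q) 1 ℚᵘ.* fracᵘ (q C i) (suc p + i) ≃
  fracᵘ (suc q C suc i) 1
p*[q+1]C[i+1]/[p+i+1]+[q+1]*qCi/[p+i+1]≃[q+1]C[i+1] p@(suc _) q i = begin
  fracᵘ p 1 ℚᵘ.* fracᵘ C₁ (p + suc i) ℚᵘ.+ fracᵘ (suc q) 1 ℚᵘ.* fracᵘ C₀ (suc p + i)
    ≈⟨ ℚᵘ.+-cong (fracᵘ-*ˡ p C₁ (p + suc i)) (fracᵘ-*ˡ (suc q) C₀ (suc p + i)) ⟩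
  fracᵘ (p * C₁) (p + suc i) ℚᵘ.+ fracᵘ (suc q * C₀) (suc p + i)
    ≡⟨ cong (λ d → fracᵘ (p * C₁) d ℚᵘ.+ fracᵘ (suc q * C₀) (suc p + i)) (+-suc p i) ⟩
  fracᵘ (p * C₁) (suc p + i) ℚᵘ.+ fracᵘ (suc q * C₀) (suc p + i)
    ≈⟨ fracᵘ-+-same (p * C₁) (suc q * C₀) (suc p + i) ⟩
  fracᵘ (p * C₁ + suc q * C₀) (suc p + i)                      ≡⟨ cong (λ c → fracᵘ c (suc p + i)) numerator≡ ⟩
  fracᵘ ((suc p + i) * C₁) (suc p + i)                         ≈⟨ fracᵘ-cancel C₁ (suc p + i) ⟩
  fracᵘ C₁ 1                                                   ∎
  where
  open ℚᵘ.≃-Reasoning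
  C₀ = q C i
  C₁ = suc q C suc i
  numerator≡ : p * C₁ + suc q * C₀ ≡ (suc p + i) * C₁
  numerator≡ = trans (cong (λ x → p * C₁ + x) (sym ([k+1]*[n+1]C[k+1]≡[n+1]*nCk q i)))
    (solve 3 (λ p i C₁ → p :* C₁ :+ (con 1 :+ i) :* C₁ := (con 1 :+ p :+ i) :* C₁) refl p i C₁)
    where open +-*-Solver

p*Sᵘ[p,q+1]+[q+1]*Sᵘ[p+1,q]≃2^[q+1] : ∀ p q → .{{NonZero p}} →
  fracᵘ p 1 ℚᵘ.* Sᵘ p (suc q) ℚᵘ.+ fracᵘ (suc q) 1 ℚᵘ.* Sᵘ (suc p) q ≃ fracᵘ (2 ^ suc q) 1
p*Sᵘ[p,q+1]+[q+1]*Sᵘ[p+1,q]≃2^[q+1] p@(suc _) q = begin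
  P ℚᵘ.* (a 0 ℚᵘ.+ ∑a) ℚᵘ.+ Q ℚᵘ.* ∑b               ≈⟨ ℚᵘ.+-congˡ (Q ℚᵘ.* ∑b) (ℚᵘ.*-distribˡ-+ P (a 0) ∑a) ⟩
  P ℚᵘ.* a 0 ℚᵘ.+ P ℚᵘ.* ∑a ℚᵘ.+ Q ℚᵘ.* ∑b          ≈⟨ ℚᵘ.+-assoc (P ℚᵘ.* a 0) (P ℚᵘ.* ∑a) (Q ℚᵘ.* ∑b) ⟩
  P ℚᵘ.* a 0 ℚᵘ.+ (P ℚᵘ.* ∑a ℚᵘ.+ Q ℚᵘ.* ∑b)
    ≈⟨ ℚᵘ.+-congʳ (P ℚᵘ.* a 0) (ℚᵘ.+-cong (*-distribˡ-sum {suc q} P (a ∘ suc ∘ toℕ)) (*-distribˡ-sum {suc q} Q (b ∘ toℕ))) ⟩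
  P ℚᵘ.* a 0 ℚᵘ.+ (∑[ i ≤ q ] (P ℚᵘ.* a (suc (toℕ i))) ℚᵘ.+ ∑[ i ≤ q ] (Q ℚᵘ.* b (toℕ i)))
    ≈⟨ ℚᵘ.+-congʳ (P ℚᵘ.* a 0) (∑-distrib-+ {suc q} (λ i → P ℚᵘ.* a (suc (toℕ i))) (λ i → Q ℚᵘ.* b (toℕ i))) ⟨
  P ℚᵘ.* a 0 ℚᵘ.+ ∑[ i ≤ q ] (P ℚᵘ.* a (suc (toℕ i)) ℚᵘ.+ Q ℚᵘ.* b (toℕ i))
    ≈⟨ ℚᵘ.+-cong P*a0≃1 (sum-cong-≋ {suc q} (p*[q+1]C[i+1]/[p+i+1]+[q+1]*qCi/[p+i+1]≃[q+1]C[i+1] p q ∘ toℕ)) ⟩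
  ∑[ i ≤ suc q ] fracᵘ (suc q C toℕ i) 1             ≈⟨ ∑fracᵘ[nCk,1]≃fracᵘ[2^n,1] (suc q) ⟩
  fracᵘ (2 ^ suc q) 1                                ∎
  where
  open ℚᵘ.≃-Reasoning
  P = fracᵘ p 1
  Q = fracᵘ (suc q) 1
  a b : ℕ → ℚᵘ
  a i = fracᵘ (suc q C i) (p + i)
  b i = fracᵘ (q C i) (suc p + i)
  ∑a = ∑[ i ≤ q ] a (suc (toℕ i))
  ∑b = ∑[ i ≤ q ] b (toℕ i)
  P*a0≃1 : P ℚᵘ.* a 0 ≃ fracᵘ 1 1
  P*a0≃1 = begin
    P ℚᵘ.* a 0              ≈⟨ fracᵘ-*ˡ p 1 (p + 0) ⟩
    fracᵘ (p * 1) (p + 0)   ≡⟨ cong (fracᵘ (p * 1)) (+-identityʳ p) ⟩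
    fracᵘ (p * 1) p         ≈⟨ fracᵘ-cancel 1 p ⟩
    fracᵘ 1 1               ∎

-- The induction on q

record V₂Argmax (p q u : ℕ) : Set where
  field
    lower   : p ≤ u
    upper   : u ≤ p + q
    maximal : ∀ w → p ≤ w → w ≤ p + q → v₂ℕ w ≤ v₂ℕ u

  strict : .{{NonZero p}} → ∀ {w} → p ≤ w → w ≤ p + q → w ≢ u → v₂ℕ w < v₂ℕ u
  strict {w} p≤w w≤p+q w≢u = ≤∧≢⇒< (maximal w p≤w w≤p+q) v₂ℕw≢v₂ℕu
    where
    instance
      _ : NonZero w
      _ = >-nonZero (<-≤-trans (>-nonZero⁻¹ p) p≤w)
      _ : NonZero u
      _ = >-nonZero (<-≤-trans (>-nonZero⁻¹ p) lower)
    v₂ℕw≢v₂ℕu : v₂ℕ w ≢ v₂ℕ u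
    v₂ℕw≢v₂ℕu v₂ℕw≡v₂ℕu with <-cmp w u
    ... | tri< w<u _ _ with v₂ℕ-between w<u v₂ℕw≡v₂ℕu
    ...   | x , w<x , x≤u , v₂ℕw<v₂ℕx =
      <⇒≱ (subst (_< v₂ℕ x) v₂ℕw≡v₂ℕu v₂ℕw<v₂ℕx) (maximal x (≤-trans p≤w (<⇒≤ w<x)) (≤-trans x≤u upper))
    v₂ℕw≢v₂ℕu v₂ℕw≡v₂ℕu | tri≈ _ w≡u _ = w≢u w≡u
    v₂ℕw≢v₂ℕu v₂ℕw≡v₂ℕu | tri> _ _ u<w with v₂ℕ-between u<w (sym v₂ℕw≡v₂ℕu)
    ...   | x , u<x , x≤w , v₂ℕu<v₂ℕx =
      <⇒≱ v₂ℕu<v₂ℕx (maximal x (≤-trans lower (<⇒≤ u<x)) (≤-trans x≤w w≤p+q))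

V₂Argmax-shrinkʳ : ∀ {p q} → V₂Argmax p (suc q) p → V₂Argmax p q p
V₂Argmax-shrinkʳ {p} {q} argmax = record
  { lower   = ≤-refl
  ; upper   = m≤m+n p q
  ; maximal = λ w p≤w w≤p+q → maximal w p≤w (≤-trans w≤p+q (+-monoʳ-≤ p (n≤1+n q)))
  }
  where open V₂Argmax argmax

V₂Argmax-shrinkˡ : ∀ {p q u} → p < u → V₂Argmax p (suc q) u → V₂Argmax (suc p) q u
V₂Argmax-shrinkˡ {p} {q} {u} p<u argmax = record
  { lower   = p<u
  ; upper   = subst (u ≤_) (+-suc p q) upper
  ; maximal = λ w p<w w≤p+q → maximal w (<⇒≤ p<w) (subst (w ≤_) (sym (+-suc p q)) w≤p+q)
  }
  where open V₂Argmax argmax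

v₂ᵘ-[q+1]*y : ∀ {q k} u y → .{{NonZero u}} → .{{ℚᵘ.Positive y}} → k ≤ q →
              v₂ᵘ y ≡ v₂ᵘ (fracᵘ (q C k) u) → v₂ᵘ (fracᵘ (suc q) 1 ℚᵘ.* y) ≡ v₂ᵘ (fracᵘ (suc q * (q C k)) u)
v₂ᵘ-[q+1]*y {q} {k} u y k≤q v₂ᵘy≡ = begin
  v₂ᵘ (fracᵘ (suc q) 1 ℚᵘ.* y)                   ≡⟨ v₂ᵘ-* (fracᵘ (suc q) 1) y ⟩
  v₂ᵘ (fracᵘ (suc q) 1) ℤ.+ v₂ᵘ y                ≡⟨ cong₂ ℤ._+_ (v₂ᵘ-fracᵘ-1 (suc q)) v₂ᵘy≡ ⟩
  + v₂ℕ (suc q) ℤ.+ v₂ᵘ (fracᵘ (q C k) u)        ≡⟨ v₂ᵘ-fracᵘ-* (suc q) (q C k) u ⟨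
  v₂ᵘ (fracᵘ (suc q * (q C k)) u)                ∎
  where
  open ≡-Reasoning
  instance _ = nCk≢0 k≤q

v₂ᵘ-[q+1]*y<v₂ᵘ-2^[q+1] : ∀ {q k} u y → .{{NonZero u}} → .{{ℚᵘ.Positive y}} → k ≤ q →
                          v₂ᵘ y ≡ v₂ᵘ (fracᵘ (q C k) u) →
                          v₂ᵘ (fracᵘ (suc q) 1 ℚᵘ.* y) ℤ.< v₂ᵘ (fracᵘ (2 ^ suc q) 1)
v₂ᵘ-[q+1]*y<v₂ᵘ-2^[q+1] {q} {k} u y k≤q v₂ᵘy≡ = begin-strict
  v₂ᵘ (fracᵘ (suc q) 1 ℚᵘ.* y)              ≡⟨ v₂ᵘ-[q+1]*y u y k≤q v₂ᵘy≡ ⟩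
  v₂ᵘ (fracᵘ (suc q * (q C k)) u)           ≡⟨ v₂ᵘ-fracᵘ (suc q * (q C k)) u ⟩
  + v₂ℕ (suc q * (q C k)) ℤ.- + v₂ℕ u       ≤⟨ ℤ.i-j≤i (+ v₂ℕ (suc q * (q C k))) (+ v₂ℕ u) ⟩
  + v₂ℕ (suc q * (q C k))                   ≤⟨ ℤ.+≤+ (v₂ℕ-[1+n]*nCk≤n k≤q) ⟩
  + q                                       <⟨ ℤ.+<+ (n<1+n q) ⟩
  + suc q                                   ≡⟨ cong +_ (v₂ℕ-2^n (suc q)) ⟨
  + v₂ℕ (2 ^ suc q)                         ≡⟨ v₂ᵘ-fracᵘ-1 (2 ^ suc q) ⟨
  v₂ᵘ (fracᵘ (2 ^ suc q) 1)                 ∎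
  where open ℤ.≤-Reasoning

v₂ᵘ-Sᵘ-step-at-p : ∀ p q → .{{NonZero p}} → V₂Argmax p (suc q) p →
                   v₂ᵘ (Sᵘ p q) ≡ v₂ᵘ (fracᵘ 1 p) → v₂ᵘ (Sᵘ p (suc q)) ≡ v₂ᵘ (fracᵘ 1 p)
v₂ᵘ-Sᵘ-step-at-p p@(suc _) q argmax v₂ᵘY≡ = ℤ-+-cancelˡ (+ v₂ℕ N) (v₂ᵘ X) (v₂ᵘ (fracᵘ 1 p)) (begin
  + v₂ℕ N ℤ.+ v₂ᵘ X                       ≡⟨ cong (ℤ._+ v₂ᵘ X) (v₂ᵘ-fracᵘ-1 N) ⟨
  v₂ᵘ (fracᵘ N 1) ℤ.+ v₂ᵘ X               ≡⟨ v₂ᵘ-* (fracᵘ N 1) X ⟨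
  v₂ᵘ (fracᵘ N 1 ℚᵘ.* X)                  ≡⟨ v₂ᵘ-cong ([p+q+1]*Sᵘ[p,q+1]≃2^[q+1]+[q+1]*Sᵘ[p,q] p q) ⟩
  v₂ᵘ (T ℚᵘ.+ Q ℚᵘ.* Y)                   ≡⟨ v₂ᵘ-cong (ℚᵘ.+-comm T (Q ℚᵘ.* Y)) ⟩
  v₂ᵘ (Q ℚᵘ.* Y ℚᵘ.+ T)                   ≡⟨ v₂ᵘ-+-< (Q ℚᵘ.* Y) T (v₂ᵘ-[q+1]*y<v₂ᵘ-2^[q+1] p Y z≤n v₂ᵘY≡) ⟩
  v₂ᵘ (Q ℚᵘ.* Y)                          ≡⟨ v₂ᵘ-* Q Y ⟩
  v₂ᵘ Q ℤ.+ v₂ᵘ Y                         ≡⟨ cong₂ ℤ._+_ (v₂ᵘ-fracᵘ-1 (suc q)) v₂ᵘY≡ ⟩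
  + v₂ℕ (suc q) ℤ.+ v₂ᵘ (fracᵘ 1 p)       ≡⟨ cong (λ k → + k ℤ.+ v₂ᵘ (fracᵘ 1 p)) v₂ℕ[q+1]≡v₂ℕN ⟩
  + v₂ℕ N ℤ.+ v₂ᵘ (fracᵘ 1 p)             ∎)
  where
  open ≡-Reasoning
  N = p + suc q
  X = Sᵘ p (suc q)
  Y = Sᵘ p q
  Q = fracᵘ (suc q) 1
  T = fracᵘ (2 ^ suc q) 1
  instance
    _ = Sᵘ-positive p q
    _ = Sᵘ-positive p (suc q)
    _ = fracᵘ-positive N 1
    _ = fracᵘ-positive (suc q) 1
    _ = fracᵘ-positive (2 ^ suc q) 1 {{m^n≢0 2 (suc q)}}
    _ = ℚᵘ.pos*pos⇒pos (fracᵘ N 1) X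
    _ = ℚᵘ.pos*pos⇒pos Q Y
    _ = ℚᵘ.pos+pos⇒pos T (Q ℚᵘ.* Y)
  v₂ℕ[q+1]≡v₂ℕN : v₂ℕ (suc q) ≡ v₂ℕ N
  v₂ℕ[q+1]≡v₂ℕN = v₂ℕ-+-summand-> p (suc q)
    (V₂Argmax.strict argmax (m≤m+n p (suc q)) ≤-refl (≢-sym (<⇒≢ (m<m+n p (s≤s z≤n)))))

v₂ᵘ-Sᵘ-step-inner : ∀ p q m → .{{NonZero p}} → V₂Argmax p (suc q) (suc p + m) →
                    v₂ᵘ (Sᵘ (suc p) q) ≡ v₂ᵘ (fracᵘ (q C m) (suc p + m)) →
                    v₂ᵘ (Sᵘ p (suc q)) ≡ v₂ᵘ (fracᵘ (suc q C suc m) (suc p + m))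
v₂ᵘ-Sᵘ-step-inner p@(suc _) q m argmax v₂ᵘY≡ = ℤ-+-cancelˡ (+ v₂ℕ p) (v₂ᵘ X) (v₂ᵘ (fracᵘ C₁ u)) (begin
  + v₂ℕ p ℤ.+ v₂ᵘ X                         ≡⟨ cong (ℤ._+ v₂ᵘ X) (v₂ᵘ-fracᵘ-1 p) ⟨
  v₂ᵘ P ℤ.+ v₂ᵘ X                           ≡⟨ v₂ᵘ-* P X ⟨
  v₂ᵘ (P ℚᵘ.* X)                            ≡⟨ v₂ᵘ-+-summand-< (Q ℚᵘ.* Y) (P ℚᵘ.* X) v₂ᵘ[QY]<v₂ᵘ[QY+PX] ⟩
  v₂ᵘ (Q ℚᵘ.* Y)                            ≡⟨ v₂ᵘ-[q+1]*y u Y m≤q v₂ᵘY≡ ⟩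
  v₂ᵘ (fracᵘ (suc q * C₀) u)                ≡⟨ cong (λ c → v₂ᵘ (fracᵘ c u)) ([k+1]*[n+1]C[k+1]≡[n+1]*nCk q m) ⟨
  v₂ᵘ (fracᵘ (suc m * C₁) u)                ≡⟨ v₂ᵘ-fracᵘ-* (suc m) C₁ u ⟩
  + v₂ℕ (suc m) ℤ.+ v₂ᵘ (fracᵘ C₁ u)        ≡⟨ cong (λ k → + k ℤ.+ v₂ᵘ (fracᵘ C₁ u)) v₂ℕ[m+1]≡v₂ℕp ⟩
  + v₂ℕ p ℤ.+ v₂ᵘ (fracᵘ C₁ u)              ∎)
  where
  open ≡-Reasoning
  u = suc p + m
  X = Sᵘ p (suc q)
  Y = Sᵘ (suc p) q
  P = fracᵘ p 1
  Q = fracᵘ (suc q) 1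
  C₀ = q C m
  C₁ = suc q C suc m
  m≤q : m ≤ q
  m≤q = +-cancelˡ-≤ p m q (≤-pred (subst (u ≤_) (+-suc p q) (V₂Argmax.upper argmax)))
  instance
    _ = Sᵘ-positive p (suc q)
    _ = Sᵘ-positive (suc p) q
    _ = fracᵘ-positive p 1
    _ = fracᵘ-positive (suc q) 1
    _ = ℚᵘ.pos*pos⇒pos P X
    _ = ℚᵘ.pos*pos⇒pos Q Y
    _ = ℚᵘ.pos+pos⇒pos (Q ℚᵘ.* Y) (P ℚᵘ.* X)
    _ = nCk≢0 (s≤s m≤q)
  v₂ᵘ[QY]<v₂ᵘ[QY+PX] : v₂ᵘ (Q ℚᵘ.* Y) ℤ.< v₂ᵘ (Q ℚᵘ.* Y ℚᵘ.+ P ℚᵘ.* X)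
  v₂ᵘ[QY]<v₂ᵘ[QY+PX] = subst (v₂ᵘ (Q ℚᵘ.* Y) ℤ.<_)
    (sym (v₂ᵘ-cong (ℚᵘ.≃-trans (ℚᵘ.+-comm (Q ℚᵘ.* Y) (P ℚᵘ.* X)) (p*Sᵘ[p,q+1]+[q+1]*Sᵘ[p+1,q]≃2^[q+1] p q))))
    (v₂ᵘ-[q+1]*y<v₂ᵘ-2^[q+1] u Y m≤q v₂ᵘY≡)
  v₂ℕ[m+1]≡v₂ℕp : v₂ℕ (suc m) ≡ v₂ℕ p
  v₂ℕ[m+1]≡v₂ℕp = v₂ℕ-+-summand-< p (suc m) (subst (λ x → v₂ℕ p < v₂ℕ x) (sym (+-suc p m))
    (V₂Argmax.strict argmax ≤-refl (m≤m+n p (suc q)) (<⇒≢ (s≤s (m≤m+n p m)))))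

v₂ᵘ-Sᵘ : ∀ q {p u} → .{{NonZero p}} → V₂Argmax p q u → v₂ᵘ (Sᵘ p q) ≡ v₂ᵘ (fracᵘ (q C (u ∸ p)) u)
v₂ᵘ-Sᵘ zero {p} {u} argmax with ≤-antisym (V₂Argmax.lower argmax) (subst (u ≤_) (+-identityʳ p) (V₂Argmax.upper argmax))
... | refl = begin
  v₂ᵘ (fracᵘ 1 (p + 0) ℚᵘ.+ ℚᵘ.0ℚᵘ)   ≡⟨ v₂ᵘ-cong (ℚᵘ.+-identityʳ (fracᵘ 1 (p + 0))) ⟩
  v₂ᵘ (fracᵘ 1 (p + 0))               ≡⟨ cong (v₂ᵘ ∘ fracᵘ 1) (+-identityʳ p) ⟩
  v₂ᵘ (fracᵘ 1 p)                     ≡⟨ cong (λ k → v₂ᵘ (fracᵘ (0 C k) p)) (n∸n≡0 p) ⟨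
  v₂ᵘ (fracᵘ (0 C (p ∸ p)) p)         ∎
  where
  open ≡-Reasoning
  instance _ = Sᵘ-positive p 0
v₂ᵘ-Sᵘ (suc q) {p} {u} argmax with m≤n⇒m<n∨m≡n (V₂Argmax.lower argmax)
... | inj₂ refl = begin
  v₂ᵘ (Sᵘ p (suc q))                 ≡⟨ v₂ᵘ-Sᵘ-step-at-p p q argmax (trans IH (cong (λ k → v₂ᵘ (fracᵘ (q C k) p)) (n∸n≡0 p))) ⟩
  v₂ᵘ (fracᵘ 1 p)                    ≡⟨ cong (λ k → v₂ᵘ (fracᵘ (suc q C k) p)) (n∸n≡0 p) ⟨
  v₂ᵘ (fracᵘ (suc q C (p ∸ p)) p)    ∎
  where
  open ≡-Reasoning
  IH = v₂ᵘ-Sᵘ q (V₂Argmax-shrinkʳ argmax)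
... | inj₁ p<u with m≤n⇒∃[o]m+o≡n p<u
...   | m , refl = begin
  v₂ᵘ (Sᵘ p (suc q))                 ≡⟨ v₂ᵘ-Sᵘ-step-inner p q m argmax (trans IH (cong (λ k → v₂ᵘ (fracᵘ (q C k) u)) (m+n∸m≡n (suc p) m))) ⟩
  v₂ᵘ (fracᵘ (suc q C suc m) u)      ≡⟨ cong (λ k → v₂ᵘ (fracᵘ (suc q C k) u)) (trans (+-∸-assoc 1 (m≤m+n p m)) (cong suc (m+n∸m≡n p m))) ⟨
  v₂ᵘ (fracᵘ (suc q C (u ∸ p)) u)    ∎
  where
  open ≡-Reasoning
  IH = v₂ᵘ-Sᵘ q {suc p} {u} (V₂Argmax-shrinkˡ p<u argmax)

toℚᵘ-frac : ∀ m d → ℚ.toℚᵘ (frac m d) ≃ fracᵘ m d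
toℚᵘ-frac m zero    = ℚᵘ.≃-refl
toℚᵘ-frac m (suc d) = ℚ.toℚᵘ-fromℚᵘ (mkℚᵘ (+ m) d)

toℚᵘ-sumℚ-applyUpTo : ∀ n (f : ℕ → ℚ) (g : ℕ → ℕ) →
                      ℚ.toℚᵘ (sumℚ (map f (applyUpTo g n))) ≃ ∑[ i < n ] ℚ.toℚᵘ (f (g (toℕ i)))
toℚᵘ-sumℚ-applyUpTo zero    f g = ℚᵘ.≃-refl
toℚᵘ-sumℚ-applyUpTo (suc n) f g = ℚᵘ.≃-trans (ℚ.toℚᵘ-homo-+ (f (g 0)) (sumℚ (map f (applyUpTo (g ∘ suc) n))))
  (ℚᵘ.+-congʳ (ℚ.toℚᵘ (f (g 0))) (toℚᵘ-sumℚ-applyUpTo n f (g ∘ suc)))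

toℚᵘ-S : ∀ p q → ℚ.toℚᵘ (S p q) ≃ Sᵘ p q
toℚᵘ-S p q = ℚᵘ.≃-trans (toℚᵘ-sumℚ-applyUpTo (suc q) (λ i → frac (q C i) (p + i)) id)
  (sum-cong-≋ {suc q} (λ i → toℚᵘ-frac (q C toℕ i) (p + toℕ i)))

v₂≡v₂ᵘ∘toℚᵘ : ∀ r → v₂ r ≡ v₂ᵘ (ℚ.toℚᵘ r)
v₂≡v₂ᵘ∘toℚᵘ (ℚ.mkℚ _ _ _) = refl

mainTheorem12 : (p q u : ℕ) → 1 ≤ p → p ≤ u → u ≤ p + q →
    ((w : ℕ) → p ≤ w → w ≤ p + q → v₂ℕ w ≤ v₂ℕ u) →
    v₂ (S p q) ≡ v₂ (frac (q C (u ∸ p)) u)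
mainTheorem12 p q u 1≤p p≤u u≤p+q maximal = begin
  v₂ (S p q)                            ≡⟨ v₂≡v₂ᵘ∘toℚᵘ (S p q) ⟩
  v₂ᵘ (ℚ.toℚᵘ (S p q))                  ≡⟨ v₂ᵘ-cong (ℚᵘ.≃-sym (toℚᵘ-S p q)) ⟨
  v₂ᵘ (Sᵘ p q)                          ≡⟨ v₂ᵘ-Sᵘ q (record { lower = p≤u ; upper = u≤p+q ; maximal = maximal }) ⟩
  v₂ᵘ (fracᵘ (q C (u ∸ p)) u)           ≡⟨ v₂ᵘ-cong (ℚᵘ.≃-sym (toℚᵘ-frac (q C (u ∸ p)) u)) ⟩
  v₂ᵘ (ℚ.toℚᵘ (frac (q C (u ∸ p)) u))   ≡⟨ v₂≡v₂ᵘ∘toℚᵘ (frac (q C (u ∸ p)) u) ⟨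
  v₂ (frac (q C (u ∸ p)) u)             ∎
  where
  open ≡-Reasoning
  instance
    _ = >-nonZero 1≤p
    _ = >-nonZero (≤-trans 1≤p p≤u)
    _ = nCk≢0 (m≤n+o⇒m∸n≤o u p u≤p+q)
    _ = Sᵘ-positive p q
    _ = fracᵘ-positive (q C (u ∸ p)) u
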